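{- Let $d\ge 4$ be an integer and let $G$ be a bipartite graph with partite sets $U$ and $W$ such that $|U|>\binom{|W|}{3}$ and every vertex in $U$ has at least $d$ neighbours in $W$. Then $G$ contains a copy of the 3-dimensional cube $Q_3$ as a subgraph.
   Context: $Q_3$ denotes the graph of the 3-dimensional cube (8 vertices, 12 edges). -}

module Defs where

open import Data.Nat using (ℕ; _+_)
open import Data.Bool using (Bool; true; false; _≟_)
open import Data.Fin using (Fin; zero; suc)
open import Data.Sum using (_⊎_; inj₁; inj₂)
open import Data.Empty using (⊥)
open import Data.Unit using (⊤)
open import Data.List using (List; length; filter)
open import Data.List.Base using (allFin)
open import Data.Product using (Σ; _×_; _,_)
open import Relation.Binary.PropositionalEquality using (_≡_)
open import Relation.Nullary using (¬_)
open import Relation.Nullary.Decidable using (Dec)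
open import Relation.Unary using (Pred; Decidable)
open import Function.Definitions using (Injective)
open import Level using (0ℓ)

-- A finite bipartite graph with partite sets U = Fin m and W = Fin n,
-- given by its (Boolean-valued) biadjacency relation.
BipGraph : ℕ → ℕ → Set
BipGraph m n = Fin m → Fin n → Bool

Vertex : ℕ → ℕ → Set
Vertex m n = Fin m ⊎ Fin n

Adj : ∀ {m n} → BipGraph m n → Vertex m n → Vertex m n → Set
Adj G (inj₁ u) (inj₂ w) = G u w ≡ true
Adj G (inj₂ w) (inj₁ u) = G u w ≡ true
Adj G (inj₁ _) (inj₁ _) = ⊥
Adj G (inj₂ _) (inj₂ _) = ⊥

degree : ∀ {m n} → BipGraph m n → Fin m → ℕ
degree {n = n} G u = length (filter (λ w → G u w ≟ true) (allFin n))

Q3Vertex : Set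
Q3Vertex = Bool × Bool × Bool

differ : Bool → Bool → ℕ
differ true  true  = 0
differ false false = 0
differ _     _     = 1

hamming : Q3Vertex → Q3Vertex → ℕ
hamming (a , b , c) (a' , b' , c') = differ a a' + differ b b' + differ c c'

Q3Adj : Q3Vertex → Q3Vertex → Set
Q3Adj x y = hamming x y ≡ 1

ContainsQ3 : ∀ {m n} → BipGraph m n → Set
ContainsQ3 {m} {n} G =
  Σ (Q3Vertex → Vertex m n) λ φ →
    Injective _≡_ _≡_ φ × (∀ x y → Q3Adj x y → Adj G (φ x) (φ y))

-- Shrink the neighbourhood of each u ∈ U to a 4-set T(u) and choose, one vertex at a time,
-- a 3-subset of T(u) different from all those chosen so far. If this succeeds for every u,
-- then |U| ≤ C(|W|,3). It fails only at a vertex whose four 3-subsets T(u) ∖ {sᵢ} have all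
-- been chosen, by distinct vertices oᵢ; then oᵢ is adjacent to sⱼ whenever i ≠ j, so the oᵢ
-- and sⱼ span K₄,₄ minus a perfect matching, which is Q₃.

module Submission where

open import Defs
open import Data.Nat using (ℕ; _≤_; _>_)
open import Data.Nat.Combinatorics using (_C_)
open import Data.Fin using (Fin)
open import Data.Fin.Patterns using (0F; 1F; 2F; 3F)

open import Data.Nat using (zero; suc; _+_; z≤n; s≤s)
open import Data.Nat.Properties using (≤-trans; <⇒≱) renaming (_≟_ to _≟ⁿ_)
open import Data.Nat.Combinatorics using (nCk+nC[k+1]≡[n+1]C[k+1])
open import Data.Fin using (zero; suc; _↑ˡ_; _↑ʳ_; splitAt; inject≤; punchIn; punchOut)
open import Data.Fin.Properties
  using (suc-injective; ↑ˡ-injective; ↑ʳ-injective; splitAt-↑ˡ; splitAt-↑ʳ;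
         punchInᵢ≢i; punchIn-punchOut; any?; all?; ¬∀⟶∃¬; injective⇒≤)
  renaming (_≟_ to _≟ᶠ_)
open import Data.Bool using (Bool; true; false; if_then_else_)
open import Data.Bool.Properties using () renaming (_≟_ to _≟ᵇ_)
open import Data.Sum using (_⊎_; inj₁; inj₂; [_,_]′) renaming (map to ⊎-map)
open import Data.Sum.Properties using (inj₁-injective; inj₂-injective) renaming (≡-dec to ⊎-≡-dec)
open import Data.Product using (_,_; proj₁; proj₂; ∃)
open import Data.Product.Properties using () renaming (≡-dec to ×-≡-dec)
open import Data.Empty using (⊥; ⊥-elim)
open import Data.List using (length; filter; tabulate)
open import Relation.Binary.PropositionalEquality
  using (_≡_; _≢_; refl; sym; trans; cong; cong₂; subst; module ≡-Reasoning)
open import Relation.Binary.Definitions using (DecidableEquality)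
open import Relation.Nullary using (¬_; Dec; yes; no; ¬?)
open import Relation.Nullary.Decidable using (map′; _×-dec_; _→-dec_; toWitness)
open import Relation.Unary using (Decidable)
open import Function using (_∘_; id)
open import Function.Definitions using (Injective)

variable
  k m n : ℕ

data Sub : ℕ → ℕ → Set where
  []   : Sub 0 0
  skip : Sub k n → Sub k (suc n)
  take : Sub k n → Sub (suc k) (suc n)

lookup : Sub k n → Fin k → Fin n
lookup (skip s) i       = suc (lookup s i)
lookup (take s) zero    = zero
lookup (take s) (suc i) = suc (lookup s i)

infix 4 _∈_ _∉_ _⊆_

_∈_ : Fin n → Sub k n → Set
x ∈ s = ∃ λ i → lookup s i ≡ x

_∉_ : Fin n → Sub k n → Set
x ∉ s = ¬ x ∈ s

_⊆_ : Sub k n → Sub m n → Set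
s ⊆ t = ∀ {x} → x ∈ s → x ∈ t

lookup-injective : (s : Sub k n) → Injective _≡_ _≡_ (lookup s)
lookup-injective (skip s) eq = lookup-injective s (suc-injective eq)
lookup-injective (take s) {zero}  {zero}  eq = refl
lookup-injective (take s) {suc i} {suc j} eq = cong suc (lookup-injective s (suc-injective eq))

remove : Sub (suc k) n → Fin (suc k) → Sub k n
remove (skip s) i               = skip (remove s i)
remove (take s) zero            = skip s
remove {suc k} (take s) (suc i) = take (remove s i)

lookup-remove : (s : Sub (suc k) n) (i : Fin (suc k)) (j : Fin k) →
                lookup (remove s i) j ≡ lookup s (punchIn i j)
lookup-remove (skip s) i j                     = cong suc (lookup-remove s i j)
lookup-remove (take s) zero j                  = refl
lookup-remove {suc k} (take s) (suc i) zero    = refl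
lookup-remove {suc k} (take s) (suc i) (suc j) = cong suc (lookup-remove s i j)

remove-⊆ : (s : Sub (suc k) n) (i : Fin (suc k)) → remove s i ⊆ s
remove-⊆ s i (j , refl) = punchIn i j , sym (lookup-remove s i j)

lookup-∈-remove : (s : Sub (suc k) n) {i j : Fin (suc k)} → i ≢ j → lookup s j ∈ remove s i
lookup-∈-remove s {i} i≢j =
  punchOut i≢j , trans (lookup-remove s i _) (cong (lookup s) (punchIn-punchOut i≢j))

lookup-∉-remove : (s : Sub (suc k) n) (i : Fin (suc k)) → lookup s i ∉ remove s i
lookup-∉-remove s i (j , eq) =
  punchInᵢ≢i i j (lookup-injective s (trans (sym (lookup-remove s i j)) eq))

remove-injective : (s : Sub (suc k) n) → Injective _≡_ _≡_ (remove s)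
remove-injective s {i} {j} eq with i ≟ᶠ j
... | yes i≡j = i≡j
... | no  i≢j = ⊥-elim (lookup-∉-remove s j (subst (lookup s j ∈_) eq (lookup-∈-remove s i≢j)))

empty : ∀ n → Sub 0 n
empty zero    = []
empty (suc n) = skip (empty n)

shrink : Sub k n → m ≤ k → Sub m n
shrink []       z≤n     = []
shrink (skip s) m≤k     = skip (shrink s m≤k)
shrink (take s) z≤n     = empty _
shrink (take s) (s≤s p) = take (shrink s p)

lookup-shrink : (s : Sub k n) (m≤k : m ≤ k) (i : Fin m) →
                lookup (shrink s m≤k) i ≡ lookup s (inject≤ i m≤k)
lookup-shrink [] z≤n ()
lookup-shrink (skip s) m≤k i           = cong suc (lookup-shrink s m≤k i)
lookup-shrink (take s) (s≤s p) zero    = refl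
lookup-shrink (take s) (s≤s p) (suc i) = cong suc (lookup-shrink s p i)

shrink-⊆ : (s : Sub k n) (m≤k : m ≤ k) → shrink s m≤k ⊆ s
shrink-⊆ s m≤k (i , refl) = inject≤ i m≤k , sym (lookup-shrink s m≤k i)

count : (Fin n → Bool) → ℕ
count {zero}  f = 0
count {suc n} f = if f zero then suc (count (f ∘ suc)) else count (f ∘ suc)

support : (f : Fin n → Bool) → Sub (count f) n
support {zero}  f = []
support {suc n} f with f zero
... | true  = take (support (f ∘ suc))
... | false = skip (support (f ∘ suc))

lookup-support : (f : Fin n → Bool) (i : Fin (count f)) → f (lookup (support f) i) ≡ true
lookup-support {suc n} f i with f zero in f0
lookup-support {suc n} f zero    | true  = f0
lookup-support {suc n} f (suc i) | true  = lookup-support (f ∘ suc) i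
lookup-support {suc n} f i       | false = lookup-support (f ∘ suc) i

∈-support : (f : Fin n → Bool) {x : Fin n} → x ∈ support f → f x ≡ true
∈-support f (i , refl) = lookup-support f i

length-filter-tabulate : (f : Fin n → Bool) (g : Fin k → Fin n) →
  length (filter (λ x → f x ≟ᵇ true) (tabulate g)) ≡ count (f ∘ g)
length-filter-tabulate {k = zero}  f g = refl
length-filter-tabulate {k = suc k} f g with f (g zero)
... | true  = cong suc (length-filter-tabulate f (g ∘ suc))
... | false = length-filter-tabulate f (g ∘ suc)

degree≡count : (G : BipGraph m n) (u : Fin m) → degree G u ≡ count (G u)
degree≡count G u = length-filter-tabulate (G u) id

neighbours : (G : BipGraph m n) → (∀ u → k ≤ degree G u) → Fin m → Sub k n
neighbours G k≤degree u = shrink (support (G u)) (subst (_ ≤_) (degree≡count G u) (k≤degree u))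

∈-neighbours : (G : BipGraph m n) (k≤degree : ∀ u → k ≤ degree G u) (u : Fin m) {x : Fin n} →
               x ∈ neighbours G k≤degree u → G u x ≡ true
∈-neighbours G k≤degree u = ∈-support (G u) ∘ shrink-⊆ (support (G u)) _

binomial : ℕ → ℕ → ℕ
binomial n       zero    = 1
binomial zero    (suc k) = 0
binomial (suc n) (suc k) = binomial n k + binomial n (suc k)

binomial≡C : ∀ n k → binomial n k ≡ n C k
binomial≡C n       zero    = refl
binomial≡C zero    (suc k) = refl
binomial≡C (suc n) (suc k) =
  trans (cong₂ _+_ (binomial≡C n k) (binomial≡C n (suc k))) (nCk+nC[k+1]≡[n+1]C[k+1] n k)

↑ˡ≢↑ʳ : ∀ m n (i : Fin m) (j : Fin n) → i ↑ˡ n ≢ m ↑ʳ j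
↑ˡ≢↑ʳ m n i j eq with trans (sym (splitAt-↑ˡ m i n)) (trans (cong (splitAt m) eq) (splitAt-↑ʳ m n j))
... | ()

encode : Sub k n → Fin (binomial n k)
encode []                       = zero
encode {zero}          (skip s) = encode s
encode {suc k} {suc n} (take s) = encode s ↑ˡ binomial n (suc k)
encode {suc k} {suc n} (skip s) = binomial n k ↑ʳ encode s

encode-injective : Injective _≡_ _≡_ (encode {k} {n})
encode-injective {x = []} {[]} _ = refl
encode-injective {zero} {x = skip s} {skip t} eq = cong skip (encode-injective eq)
encode-injective {suc k} {suc n} {take s} {take t} eq =
  cong take (encode-injective (↑ˡ-injective (binomial n (suc k)) _ _ eq))
encode-injective {suc k} {suc n} {skip s} {skip t} eq =
  cong skip (encode-injective (↑ʳ-injective (binomial n k) _ _ eq))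
encode-injective {suc k} {suc n} {take s} {skip t} eq = ⊥-elim (↑ˡ≢↑ʳ _ _ _ _ eq)
encode-injective {suc k} {suc n} {skip s} {take t} eq = ⊥-elim (↑ˡ≢↑ʳ _ _ _ _ (sym eq))

_≟_ : DecidableEquality (Sub k n)
s ≟ t = map′ encode-injective (cong encode) (encode s ≟ᶠ encode t)

record FaceCover (T : Fin m → Sub (suc k) n) : Set where
  field
    base            : Sub (suc k) n
    owner           : Fin (suc k) → Fin m
    owner-injective : Injective _≡_ _≡_ owner
    face⊆owner      : ∀ i → remove base i ⊆ T (owner i)

record DistinctFaces (T : Fin m → Sub (suc k) n) : Set where
  field
    choice : Fin m → Fin (suc k)

  face : Fin m → Sub k n
  face u = remove (T u) (choice u)

  field
    face-injective : Injective _≡_ _≡_ face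

open DistinctFaces

module _ {T : Fin (suc m) → Sub (suc k) n} where

  Taken : DistinctFaces (T ∘ suc) → Fin (suc k) → Set
  Taken D i = ∃ λ v → remove (T zero) i ≡ face D v

  taken? : (D : DistinctFaces (T ∘ suc)) → Decidable (Taken D)
  taken? D i = any? (λ v → remove (T zero) i ≟ face D v)

  cover-tail : FaceCover (T ∘ suc) → FaceCover T
  cover-tail cover = record
    { base            = base
    ; owner           = suc ∘ owner
    ; owner-injective = owner-injective ∘ suc-injective
    ; face⊆owner      = face⊆owner
    }
    where open FaceCover cover

  cover-head : (D : DistinctFaces (T ∘ suc)) → (∀ i → Taken D i) → FaceCover T
  cover-head D taken = record
    { base = T zero ; owner = suc ∘ v ; owner-injective = injective ; face⊆owner = face⊆T }
    where
    v : Fin (suc k) → Fin m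
    v = proj₁ ∘ taken

    injective : Injective _≡_ _≡_ (suc ∘ v)
    injective {i} {j} eq = remove-injective (T zero) (begin
      remove (T zero) i  ≡⟨ proj₂ (taken i) ⟩
      face D (v i)       ≡⟨ cong (face D) (suc-injective eq) ⟩
      face D (v j)       ≡⟨ proj₂ (taken j) ⟨
      remove (T zero) j  ∎)
      where open ≡-Reasoning

    face⊆T : ∀ i → remove (T zero) i ⊆ T (suc (v i))
    face⊆T i =
      subst (_⊆ T (suc (v i))) (sym (proj₂ (taken i))) (remove-⊆ (T (suc (v i))) (choice D (v i)))

  faces-cons : (D : DistinctFaces (T ∘ suc)) (i : Fin (suc k)) → ¬ Taken D i → DistinctFaces T
  faces-cons D i fresh = record { choice = choice′ ; face-injective = injective }
    where
    choice′ : Fin (suc m) → Fin (suc k)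
    choice′ zero    = i
    choice′ (suc v) = choice D v

    injective : Injective _≡_ _≡_ (λ u → remove (T u) (choice′ u))
    injective {zero}  {zero}  eq = refl
    injective {zero}  {suc v} eq = ⊥-elim (fresh (v , eq))
    injective {suc u} {zero}  eq = ⊥-elim (fresh (u , sym eq))
    injective {suc u} {suc v} eq = cong suc (face-injective D eq)

faceCover-or-distinctFaces : (T : Fin m → Sub (suc k) n) → FaceCover T ⊎ DistinctFaces T
faceCover-or-distinctFaces {zero} T = inj₂ (record { choice = λ () ; face-injective = λ { {()} } })
faceCover-or-distinctFaces {suc m} T with faceCover-or-distinctFaces (T ∘ suc)
... | inj₁ cover = inj₁ (cover-tail cover)
... | inj₂ D with all? (taken? {T = T} D)
...   | yes allTaken = inj₁ (cover-head D allTaken)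
...   | no ¬allTaken =
  let i , fresh = ¬∀⟶∃¬ _ _ (taken? {T = T} D) ¬allTaken in inj₂ (faces-cons D i fresh)

CrownAdj : Fin k ⊎ Fin k → Fin k ⊎ Fin k → Set
CrownAdj (inj₁ i) (inj₂ j) = i ≢ j
CrownAdj (inj₂ i) (inj₁ j) = i ≢ j
CrownAdj (inj₁ _) (inj₁ _) = ⊥
CrownAdj (inj₂ _) (inj₂ _) = ⊥

crownAdj? : (a b : Fin k ⊎ Fin k) → Dec (CrownAdj a b)
crownAdj? (inj₁ i) (inj₂ j) = ¬? (i ≟ᶠ j)
crownAdj? (inj₂ i) (inj₁ j) = ¬? (i ≟ᶠ j)
crownAdj? (inj₁ _) (inj₁ _) = no λ ()
crownAdj? (inj₂ _) (inj₂ _) = no λ ()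

-- Antipodal vertices get the same index: Q₃ is K₄,₄ minus the matching of antipodal pairs.
toCrown : Q3Vertex → Fin 4 ⊎ Fin 4
toCrown (false , false , false) = inj₁ 0F
toCrown (false , true  , true ) = inj₁ 1F
toCrown (true  , false , true ) = inj₁ 2F
toCrown (true  , true  , false) = inj₁ 3F
toCrown (true  , true  , true ) = inj₂ 0F
toCrown (true  , false , false) = inj₂ 1F
toCrown (false , true  , false) = inj₂ 2F
toCrown (false , false , true ) = inj₂ 3F

all-Bool? : {P : Bool → Set} → Decidable P → Dec (∀ b → P b)
all-Bool? P? =
  map′ (λ (f , t) → λ { false → f ; true → t }) (λ p → p false , p true) (P? false ×-dec P? true)

all-Q3? : {P : Q3Vertex → Set} → Decidable P → Dec (∀ x → P x)
all-Q3? P? = map′ (λ p (a , b , c) → p a b c) (λ p a b c → p (a , b , c))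
  (all-Bool? λ a → all-Bool? λ b → all-Bool? λ c → P? (a , b , c))

toCrown-injective : Injective _≡_ _≡_ toCrown
toCrown-injective {x} {y} =
  toWitness {a? = all-Q3? λ x → all-Q3? λ y → (toCrown x ≟ˢ toCrown y) →-dec (x ≟ᵛ y)} _ x y
  where
  _≟ˢ_ : DecidableEquality (Fin 4 ⊎ Fin 4)
  _≟ˢ_ = ⊎-≡-dec _≟ᶠ_ _≟ᶠ_
  _≟ᵛ_ : DecidableEquality Q3Vertex
  _≟ᵛ_ = ×-≡-dec _≟ᵇ_ (×-≡-dec _≟ᵇ_ _≟ᵇ_)

toCrown-adj : ∀ x y → Q3Adj x y → CrownAdj (toCrown x) (toCrown y)
toCrown-adj = toWitness
  {a? = all-Q3? λ x → all-Q3? λ y → (hamming x y ≟ⁿ 1) →-dec crownAdj? (toCrown x) (toCrown y)} _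

crown⇒containsQ3 : (G : BipGraph m n) (o : Fin 4 → Fin m) (s : Fin 4 → Fin n) →
  Injective _≡_ _≡_ o → Injective _≡_ _≡_ s →
  (∀ {i j} → i ≢ j → G (o i) (s j) ≡ true) → ContainsQ3 G
crown⇒containsQ3 G o s o-injective s-injective adj =
  ψ ∘ toCrown , toCrown-injective ∘ ψ-injective , λ x y → ψ-adj _ _ ∘ toCrown-adj x y
  where
  ψ : Fin 4 ⊎ Fin 4 → Vertex _ _
  ψ = ⊎-map o s

  ψ-injective : Injective _≡_ _≡_ ψ
  ψ-injective {inj₁ i} {inj₁ j} eq = cong inj₁ (o-injective (inj₁-injective eq))
  ψ-injective {inj₂ i} {inj₂ j} eq = cong inj₂ (s-injective (inj₂-injective eq))

  ψ-adj : ∀ a b → CrownAdj a b → Adj G (ψ a) (ψ b)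
  ψ-adj (inj₁ i) (inj₂ j) i≢j = adj i≢j
  ψ-adj (inj₂ i) (inj₁ j) i≢j = adj (i≢j ∘ sym)

faceCover⇒containsQ3 : (G : BipGraph m n) (T : Fin m → Sub 4 n) →
  (∀ u {x} → x ∈ T u → G u x ≡ true) → FaceCover T → ContainsQ3 G
faceCover⇒containsQ3 G T T⊆N cover =
  crown⇒containsQ3 G owner (lookup base) owner-injective (lookup-injective base)
    λ i≢j → T⊆N _ (face⊆owner _ (lookup-∈-remove base i≢j))
  where open FaceCover cover

distinctFaces⇒≤ : {T : Fin m → Sub (suc k) n} → DistinctFaces T → m ≤ n C k
distinctFaces⇒≤ {m} {k} {n} faces =
  subst (m ≤_) (binomial≡C n k) (injective⇒≤ (face-injective faces ∘ encode-injective))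

proposition2p1 : (d m n : ℕ) → 4 ≤ d → (G : BipGraph m n) →
    m > n C 3 → (∀ (u : Fin m) → d ≤ degree G u) → ContainsQ3 G
proposition2p1 d m n 4≤d G m>nC3 d≤degree =
  [ faceCover⇒containsQ3 G T (∈-neighbours G 4≤degree)
  , (λ faces → ⊥-elim (<⇒≱ m>nC3 (distinctFaces⇒≤ faces)))
  ]′ (faceCover-or-distinctFaces T)
  where
  4≤degree : ∀ u → 4 ≤ degree G u
  4≤degree u = ≤-trans 4≤d (d≤degree u)

  T : Fin m → Sub 4 n
  T = neighbours G 4≤degree
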